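{- Let $(f,M)$ be a polymatroid. For arbitrary subsets $A,B,P,Q,Y,E\subseteq M$, $$\mathrm{Ing}(A,B;P,Q\mid E)+\mathrm{Comm}(A,B;Y\mid E)\ge 0,$$ where $\mathrm{Comm}(A,B;Y\mid E)=f(A,B\mid YE)+f(Y\mid AE)+f(Y\mid BE)+f(Y\mid ABE)$ and $\mathrm{Ing}(A,B;P,Q\mid E)=-f(A,B\mid E)+f(A,B\mid PE)+f(A,B\mid QE)+f(P,Q\mid E)$.
   Context: A polymatroid $(f,M)$: finite $M$, $f$ on subsets of $M$ (with $f(\emptyset)=0$), non-negative, monotone, submodular. Juxtaposition denotes union ($YE=Y\cup E$ etc.). For subsets $I,J,K$: $f(I,J\mid K)=f(IK)+f(JK)-f(K)-f(IJK)$ and $f(I\mid K)=f(IK)-f(K)$; no disjointness is assumed. -}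

module Defs where

open import Level using (Level; suc; _⊔_)
open import Data.Nat using (ℕ)
open import Data.Fin.Subset using (Subset; ⊥; _∪_; _∩_; _⊆_)
open import Relation.Binary.PropositionalEquality using (_≡_)
open import Algebra.Structures using (IsAbelianGroup)
open import Relation.Binary.Structures using (IsPartialOrder)

-- Values of the rank function: an ordered abelian group
-- (e.g. the real numbers, which are not available in agda-stdlib).
-- Equality is propositional equality.
record OrderedAbelianGroup (c ℓ : Level) : Set (suc (c ⊔ ℓ)) where
  infixl 6 _+_ _-_
  infix  8 -_
  infix  4 _≤_
  field
    Carrier       : Set c
    _+_           : Carrier → Carrier → Carrier
    0#            : Carrier
    -_            : Carrier → Carrier
    _≤_           : Carrier → Carrier → Set ℓ
    isAbelianGroup : IsAbelianGroup _≡_ _+_ 0# -_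
    isPartialOrder : IsPartialOrder _≡_ _≤_
    +-monoˡ-≤     : ∀ {x y} z → x ≤ y → x + z ≤ y + z

  _-_ : Carrier → Carrier → Carrier
  x - y = x + (- y)

module _ {c ℓ : Level} (G : OrderedAbelianGroup c ℓ) {n : ℕ} where
  open OrderedAbelianGroup G

  record IsPolymatroid (f : Subset n → Carrier) : Set (c ⊔ ℓ) where
    field
      empty       : f ⊥ ≡ 0#
      nonneg      : ∀ X → 0# ≤ f X
      monotone    : ∀ {X Y} → X ⊆ Y → f X ≤ f Y
      submodular  : ∀ X Y → f (X ∪ Y) + f (X ∩ Y) ≤ f X + f Y

  module _ (f : Subset n → Carrier) where
    cmi : Subset n → Subset n → Subset n → Carrier
    cmi I J K = f (I ∪ K) + f (J ∪ K) - f K - f (I ∪ J ∪ K)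

    cond : Subset n → Subset n → Carrier
    cond I K = f (I ∪ K) - f K

    Comm : Subset n → Subset n → Subset n → Subset n → Carrier
    Comm A B Y E = cmi A B (Y ∪ E) + cond Y (A ∪ E) + cond Y (B ∪ E)
                   + cond Y (A ∪ B ∪ E)

    Ing : Subset n → Subset n → Subset n → Subset n → Subset n → Carrier
    Ing A B P Q E = - cmi A B E + cmi A B (P ∪ E) + cmi A B (Q ∪ E)
                    + cmi P Q E

-- Conditioning on E throughout, write H(Y|X) for cond and I(A;B|X) for cmi. The interaction
-- information is symmetric: I(A;B) + H(Y|A) + H(Y|B) = I(A;B|Y) + H(Y) + H(Y|AB). Hence
-- H(Y|X) ≤ I(A;B|X) + H(Y|A) + H(Y|B) for every X (conditioning on X only lowers H(Y|A), H(Y|B)),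
-- and likewise H(Y) ≤ I(P;Q) + H(Y|P) + H(Y|Q). Chaining these with X = P and X = Q bounds H(Y)
-- by I(P;Q) + I(A;B|P) + I(A;B|Q) + 2H(Y|A) + 2H(Y|B), which by the symmetry identity once more
-- is Ing + Comm + H(Y).
module Submission where

open import Defs
open import Level using (Level)
open import Data.Nat using (ℕ)
open import Data.Fin.Subset using (Subset; _∪_; _∩_; _⊆_)
open import Data.Fin.Subset.Properties
  using (⊆-refl; p⊆p∪q; q⊆p∪q; x∈p∪q⁺; x∈p∪q⁻; x∈p∩q⁺; ∪-commutativeMonoid)
open import Data.Product using (_,_)
import Data.Sum as Sum
open import Relation.Binary.PropositionalEquality
  using (_≡_; refl; sym; trans; cong; subst; subst₂; module ≡-Reasoning)
open import Relation.Binary.Bundles using (Poset)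
open import Relation.Binary.Structures using (IsPartialOrder)
import Relation.Binary.Reasoning.PartialOrder as PartialOrderReasoning
open import Algebra.Bundles using (AbelianGroup; CommutativeMonoid)
import Algebra.Properties.CommutativeSemigroup as CommutativeSemigroupProperties
import Algebra.Solver.CommutativeMonoid as CommutativeMonoidSolver

∪-mono-⊆ : ∀ {n} {P P′ Q Q′ : Subset n} → P ⊆ P′ → Q ⊆ Q′ → P ∪ Q ⊆ P′ ∪ Q′
∪-mono-⊆ {P = P} {Q = Q} P⊆P′ Q⊆Q′ x∈P∪Q =
  x∈p∪q⁺ (Sum.map P⊆P′ Q⊆Q′ (x∈p∪q⁻ P Q x∈P∪Q))

∪-leftComm : ∀ {n} (X Y Z : Subset n) → X ∪ (Y ∪ Z) ≡ Y ∪ (X ∪ Z)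
∪-leftComm {n} = x∙yz≈y∙xz
  where open CommutativeSemigroupProperties
               (CommutativeMonoid.commutativeSemigroup (∪-commutativeMonoid n))

module OrderedAbelianGroupProperties {c ℓ : Level} (G : OrderedAbelianGroup c ℓ) where
  open OrderedAbelianGroup G

  abelianGroup : AbelianGroup c c
  abelianGroup = record { isAbelianGroup = isAbelianGroup }

  open import Algebra.Properties.AbelianGroup abelianGroup public using (⁻¹-anti-homo‿-)
  open AbelianGroup abelianGroup public
    using (assoc; comm; identityˡ; identityʳ; inverseˡ; inverseʳ; commutativeMonoid)
  -- The solver sees a negated term as an opaque atom; cancellations are done by hand.
  open CommutativeMonoidSolver commutativeMonoid public using (solve; _⊜_; _⊕_)
  open IsPartialOrder isPartialOrder using () renaming (trans to ≤-trans)

  poset : Poset c c ℓ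
  poset = record { isPartialOrder = isPartialOrder }

  module ≤-Reasoning = PartialOrderReasoning poset

  +-monoʳ-≤ : ∀ z {x y} → x ≤ y → z + x ≤ z + y
  +-monoʳ-≤ z {x} {y} x≤y = subst₂ _≤_ (comm x z) (comm y z) (+-monoˡ-≤ z x≤y)

  +-mono-≤ : ∀ {x y u v} → x ≤ y → u ≤ v → x + u ≤ y + v
  +-mono-≤ {y = y} {u} x≤y u≤v = ≤-trans (+-monoˡ-≤ u x≤y) (+-monoʳ-≤ y u≤v)

  0≤x⇒0≤y⇒0≤x+y : ∀ {x y} → 0# ≤ x → 0# ≤ y → 0# ≤ x + y
  0≤x⇒0≤y⇒0≤x+y {x} {y} 0≤x 0≤y = subst (_≤ x + y) (identityʳ 0#) (+-mono-≤ 0≤x 0≤y)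

  x≤x+y : ∀ x {y} → 0# ≤ y → x ≤ x + y
  x≤x+y x {y} 0≤y = subst (_≤ x + y) (identityʳ x) (+-monoʳ-≤ x 0≤y)

  x+[y-y]≡x : ∀ x y → x + (y - y) ≡ x
  x+[y-y]≡x x y = trans (cong (x +_) (inverseʳ y)) (identityʳ x)

  [x-x]+y≡y : ∀ x y → (x - x) + y ≡ y
  [x-x]+y≡y x y = trans (cong (_+ y) (inverseʳ x)) (identityˡ y)

  -x+[x+y]≡y : ∀ x y → - x + (x + y) ≡ y
  -x+[x+y]≡y x y = trans (sym (assoc (- x) x y)) (trans (cong (_+ y) (inverseˡ x)) (identityˡ y))

  x≤y⇒0≤y-x : ∀ {x y} → x ≤ y → 0# ≤ y - x
  x≤y⇒0≤y-x {x} {y} x≤y = subst (_≤ y - x) (inverseʳ x) (+-monoˡ-≤ (- x) x≤y)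

  y≤x+y⇒0≤x : ∀ {x y} → y ≤ x + y → 0# ≤ x
  y≤x+y⇒0≤x {x} {y} y≤x+y =
    subst₂ _≤_ (inverseʳ y) (trans (assoc x y (- y)) (x+[y-y]≡x x y)) (+-monoˡ-≤ (- y) y≤x+y)

  x+w≤z+y⇒x-y≤z-w : ∀ {x y z w} → x + w ≤ z + y → x - y ≤ z - w
  x+w≤z+y⇒x-y≤z-w {x} {y} {z} {w} x+w≤z+y = subst₂ _≤_ left right (+-monoˡ-≤ (- y + - w) x+w≤z+y)
    where
    left : x + w + (- y + - w) ≡ x - y
    left = trans (solve 4 (λ x w y⁻ w⁻ → (x ⊕ w) ⊕ (y⁻ ⊕ w⁻) ⊜ (x ⊕ y⁻) ⊕ (w ⊕ w⁻)) refl x w (- y) (- w))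
                 (x+[y-y]≡x (x - y) w)
    right : z + y + (- y + - w) ≡ z - w
    right = trans (solve 4 (λ z y y⁻ w⁻ → (z ⊕ y) ⊕ (y⁻ ⊕ w⁻) ⊜ (z ⊕ w⁻) ⊕ (y ⊕ y⁻)) refl z y (- y) (- w))
                  (x+[y-y]≡x (z - w) y)

module PolymatroidProperties {c ℓ : Level} (G : OrderedAbelianGroup c ℓ) {n : ℕ}
    (f : Subset n → OrderedAbelianGroup.Carrier G) where
  open OrderedAbelianGroup G
  open OrderedAbelianGroupProperties G

  cmi≡cond-cond : ∀ I J K → cmi G f I J K ≡ cond G f I K - cond G f I (J ∪ K)
  cmi≡cond-cond I J K = begin
    f (I ∪ K) + f (J ∪ K) - f K - f (I ∪ J ∪ K)
      ≡⟨ solve 4 (λ ik jk k⁻ ijk⁻ → ((ik ⊕ jk) ⊕ k⁻) ⊕ ijk⁻ ⊜ (ik ⊕ k⁻) ⊕ (jk ⊕ ijk⁻)) refl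
           (f (I ∪ K)) (f (J ∪ K)) (- f K) (- f (I ∪ J ∪ K)) ⟩
    (f (I ∪ K) - f K) + (f (J ∪ K) - f (I ∪ J ∪ K))
      ≡⟨ cong (f (I ∪ K) - f K +_) (⁻¹-anti-homo‿- (f (I ∪ J ∪ K)) (f (J ∪ K))) ⟨
    (f (I ∪ K) - f K) - (f (I ∪ J ∪ K) - f (J ∪ K)) ∎
    where open ≡-Reasoning

  cmi+cond+cond≡cmi+cond+cond : ∀ A B Y K →
    cmi G f A B K + cond G f Y (A ∪ K) + cond G f Y (B ∪ K)
      ≡ cmi G f A B (Y ∪ K) + cond G f Y K + cond G f Y (A ∪ B ∪ K)
  cmi+cond+cond≡cmi+cond+cond A B Y K
    rewrite ∪-leftComm Y A (B ∪ K) | ∪-leftComm Y B K | ∪-leftComm Y A K = begin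
    f a + f b - f K - f ab + (f ay - f a) + (f by - f b)
      ≡⟨ solve 8 (λ a a⁻ b b⁻ k⁻ ab⁻ ay by →
                  ((((a ⊕ b) ⊕ k⁻) ⊕ ab⁻) ⊕ (ay ⊕ a⁻)) ⊕ (by ⊕ b⁻)
                    ⊜ (a ⊕ a⁻) ⊕ ((b ⊕ b⁻) ⊕ (((ay ⊕ by) ⊕ k⁻) ⊕ ab⁻))) refl
           (f a) (- f a) (f b) (- f b) (- f K) (- f ab) (f ay) (f by) ⟩
    (f a - f a) + ((f b - f b) + core)
      ≡⟨ trans ([x-x]+y≡y (f a) _) ([x-x]+y≡y (f b) core) ⟩
    core
      ≡⟨ trans ([x-x]+y≡y (f y) _) ([x-x]+y≡y (f aby) core) ⟨
    (f y - f y) + ((f aby - f aby) + core)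
      ≡⟨ solve 8 (λ y y⁻ aby aby⁻ k⁻ ab⁻ ay by →
                  (y ⊕ y⁻) ⊕ ((aby ⊕ aby⁻) ⊕ (((ay ⊕ by) ⊕ k⁻) ⊕ ab⁻))
                    ⊜ ((((ay ⊕ by) ⊕ y⁻) ⊕ aby⁻) ⊕ (y ⊕ k⁻)) ⊕ (aby ⊕ ab⁻)) refl
           (f y) (- f y) (f aby) (- f aby) (- f K) (- f ab) (f ay) (f by) ⟩
    f ay + f by - f y - f aby + (f y - f K) + (f aby - f ab) ∎
    where
    open ≡-Reasoning
    a b ab y ay by aby : Subset n
    a = A ∪ K
    b = B ∪ K
    ab = A ∪ B ∪ K
    y = Y ∪ K
    ay = A ∪ Y ∪ K
    by = B ∪ Y ∪ K
    aby = A ∪ B ∪ Y ∪ K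
    core : Carrier
    core = f ay + f by - f K - f ab

  Ing+Comm+cond-rearrange : ∀ A B P Q Y E →
    Ing G f A B P Q E + Comm G f A B Y E + cond G f Y E
      ≡ cmi G f P Q E
        + (cmi G f A B (P ∪ E) + cond G f Y (A ∪ E) + cond G f Y (B ∪ E))
        + (cmi G f A B (Q ∪ E) + cond G f Y (A ∪ E) + cond G f Y (B ∪ E))
  Ing+Comm+cond-rearrange A B P Q Y E = begin
    - i + p + q + r + (j + a + b + ab) + y
      ≡⟨ solve 9 (λ i⁻ p q r j a b ab y →
                  ((((i⁻ ⊕ p) ⊕ q) ⊕ r) ⊕ (((j ⊕ a) ⊕ b) ⊕ ab)) ⊕ y
                    ⊜ i⁻ ⊕ (((j ⊕ y) ⊕ ab) ⊕ ((((r ⊕ p) ⊕ q) ⊕ a) ⊕ b))) refl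
           (- i) p q r j a b ab y ⟩
    - i + (j + y + ab + (r + p + q + a + b))
      ≡⟨ cong (λ t → - i + (t + (r + p + q + a + b))) (cmi+cond+cond≡cmi+cond+cond A B Y E) ⟨
    - i + (i + a + b + (r + p + q + a + b))
      ≡⟨ cong (- i +_) (solve 6 (λ i a b r p q →
                  ((i ⊕ a) ⊕ b) ⊕ ((((r ⊕ p) ⊕ q) ⊕ a) ⊕ b)
                    ⊜ i ⊕ ((r ⊕ ((p ⊕ a) ⊕ b)) ⊕ ((q ⊕ a) ⊕ b))) refl i a b r p q) ⟩
    - i + (i + (r + (p + a + b) + (q + a + b)))
      ≡⟨ -x+[x+y]≡y i _ ⟩
    r + (p + a + b) + (q + a + b) ∎
    where
    open ≡-Reasoning
    i p q r j a b ab y : Carrier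
    i = cmi G f A B E
    p = cmi G f A B (P ∪ E)
    q = cmi G f A B (Q ∪ E)
    r = cmi G f P Q E
    j = cmi G f A B (Y ∪ E)
    a = cond G f Y (A ∪ E)
    b = cond G f Y (B ∪ E)
    ab = cond G f Y (A ∪ B ∪ E)
    y = cond G f Y E

  module _ (isPolymatroid : IsPolymatroid G f) where
    open IsPolymatroid isPolymatroid

    cond-nonneg : ∀ I K → 0# ≤ cond G f I K
    cond-nonneg I K = x≤y⇒0≤y-x (monotone (q⊆p∪q I K))

    cond-antitone : ∀ I {K K′} → K ⊆ K′ → cond G f I K′ ≤ cond G f I K
    cond-antitone I {K} {K′} K⊆K′ = x+w≤z+y⇒x-y≤z-w (begin
      f (I ∪ K′) + f K
        ≤⟨ +-mono-≤ (monotone (∪-mono-⊆ (p⊆p∪q K) ⊆-refl))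
                    (monotone (λ x∈K → x∈p∩q⁺ (q⊆p∪q I K x∈K , K⊆K′ x∈K))) ⟩
      f ((I ∪ K) ∪ K′) + f ((I ∪ K) ∩ K′)
        ≤⟨ submodular (I ∪ K) K′ ⟩
      f (I ∪ K) + f K′ ∎)
      where open ≤-Reasoning

    cmi-nonneg : ∀ I J K → 0# ≤ cmi G f I J K
    cmi-nonneg I J K =
      subst (0# ≤_) (sym (cmi≡cond-cond I J K)) (x≤y⇒0≤y-x (cond-antitone I (q⊆p∪q J K)))

    cond≤cmi+cond+cond : ∀ A B Y {K K′} → K ⊆ K′ →
      cond G f Y K′ ≤ cmi G f A B K′ + cond G f Y (A ∪ K) + cond G f Y (B ∪ K)
    cond≤cmi+cond+cond A B Y {K} {K′} K⊆K′ = begin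
      cond G f Y K′
        ≤⟨ x≤x+y _ (0≤x⇒0≤y⇒0≤x+y (cmi-nonneg A B (Y ∪ K′)) (cond-nonneg Y (A ∪ B ∪ K′))) ⟩
      cond G f Y K′ + (cmi G f A B (Y ∪ K′) + cond G f Y (A ∪ B ∪ K′))
        ≡⟨ solve 3 (λ y j ab → y ⊕ (j ⊕ ab) ⊜ (j ⊕ y) ⊕ ab) refl _ _ _ ⟩
      cmi G f A B (Y ∪ K′) + cond G f Y K′ + cond G f Y (A ∪ B ∪ K′)
        ≡⟨ cmi+cond+cond≡cmi+cond+cond A B Y K′ ⟨
      cmi G f A B K′ + cond G f Y (A ∪ K′) + cond G f Y (B ∪ K′)
        ≤⟨ +-mono-≤ (+-monoʳ-≤ _ (cond-antitone Y (∪-mono-⊆ ⊆-refl K⊆K′)))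
                    (cond-antitone Y (∪-mono-⊆ ⊆-refl K⊆K′)) ⟩
      cmi G f A B K′ + cond G f Y (A ∪ K) + cond G f Y (B ∪ K) ∎
      where open ≤-Reasoning

lemma6 : ∀ {c ℓ : Level} (G : OrderedAbelianGroup c ℓ) {n : ℕ}
           (f : Subset n → OrderedAbelianGroup.Carrier G) →
           IsPolymatroid G f →
           (A B P Q Y E : Subset n) →
           OrderedAbelianGroup._≤_ G (OrderedAbelianGroup.0# G)
             (OrderedAbelianGroup._+_ G (Ing G f A B P Q E) (Comm G f A B Y E))
lemma6 G f isPolymatroid A B P Q Y E = y≤x+y⇒0≤x (begin
  cond G f Y E
    ≤⟨ cond≤cmi+cond+cond isPolymatroid P Q Y ⊆-refl ⟩
  cmi G f P Q E + cond G f Y (P ∪ E) + cond G f Y (Q ∪ E)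
    ≤⟨ +-mono-≤ (+-monoʳ-≤ _ (condBound P)) (condBound Q) ⟩
  cmi G f P Q E
    + (cmi G f A B (P ∪ E) + cond G f Y (A ∪ E) + cond G f Y (B ∪ E))
    + (cmi G f A B (Q ∪ E) + cond G f Y (A ∪ E) + cond G f Y (B ∪ E))
    ≡⟨ Ing+Comm+cond-rearrange A B P Q Y E ⟨
  Ing G f A B P Q E + Comm G f A B Y E + cond G f Y E ∎)
  where
  open OrderedAbelianGroup G
  open OrderedAbelianGroupProperties G
  open PolymatroidProperties G f
  open ≤-Reasoning
  condBound : ∀ X →
    cond G f Y (X ∪ E) ≤ cmi G f A B (X ∪ E) + cond G f Y (A ∪ E) + cond G f Y (B ∪ E)
  condBound X = cond≤cmi+cond+cond isPolymatroid A B Y (q⊆p∪q X E)
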